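{- Let $K$ be a number field, $n\ge1$, and let $(X_0:\cdots:X_n)$ be projective coordinates on $\mathbb{P}^n(K)$. Let $L_0$ be the hyperplane $X_0+\cdots+X_n=0$ and, for $0\le i\le n$, let $H_i$ be the hyperplane $X_i=0$. Let $L$ be a projective line of $\mathbb{P}^n(K)$ contained in $L_0$. Assume that $L$ contains a point with projective coordinates $(u_0:\cdots:u_n)$ such that $u_0\cdots u_n\neq0$ and such that no sum $\sum_{i\in I}u_i$ vanishes for any subset $I\subseteq\{0,\dots,n\}$ with at least one and at most $n$ elements. Then among the $n+1$ subsets $L\cap H_0,\dots,L\cap H_n$ of $L$, at least $3$ are distinct. -}

module Defs where

open import Level using (Level; _⊔_) renaming (suc to lsuc)
open import Data.Nat using (ℕ; suc; _≤_)
open import Data.Fin using (Fin)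
open import Data.Fin.Subset using (Subset; ∣_∣)
open import Data.Vec using (lookup)
open import Data.Bool using (if_then_else_)
open import Data.Product using (Σ; ∃; _×_; _,_)
open import Relation.Nullary using (¬_; yes; no)
open import Relation.Binary using (Decidable)
open import Algebra.Bundles using (CommutativeRing)
import Algebra.Properties.Monoid.Sum as MonoidSum

-- A (commutative) field with decidable equality: a commutative ring with
-- 0 ≠ 1 in which every nonzero element has a multiplicative inverse.
-- (Number fields are such fields.)
record Field (c ℓ : Level) : Set (lsuc (c ⊔ ℓ)) where
  field
    commutativeRing : CommutativeRing c ℓ
  open CommutativeRing commutativeRing public
  field
    _≟_     : Decidable _≈_
    0≉1     : ¬ (0# ≈ 1#)
    inverse : ∀ x → ¬ (x ≈ 0#) → Σ Carrier λ y → x * y ≈ 1#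

module Proj {c ℓ : Level} (K : Field c ℓ) where
  open Field K

  Coord : ℕ → Set c
  Coord n = Fin (suc n) → Carrier

  Σ⟨_⟩ : ∀ {n} → Coord n → Carrier
  Σ⟨ u ⟩ = MonoidSum.sum +-monoid u

  Π⟨_⟩ : ∀ {n} → Coord n → Carrier
  Π⟨ u ⟩ = MonoidSum.sum *-monoid u

  sumOver : ∀ {n} → Subset (suc n) → Coord n → Carrier
  sumOver I u = Σ⟨ (λ i → if lookup I i then u i else 0#) ⟩

  NonZeroVec : ∀ {n} → Coord n → Set ℓ
  NonZeroVec u = ∃ λ i → ¬ (u i ≈ 0#)

  LinIndep : ∀ {n} → Coord n → Coord n → Set (c ⊔ ℓ)
  LinIndep p q = ∀ s t → (∀ i → s * p i + t * q i ≈ 0#) → (s ≈ 0#) × (t ≈ 0#)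

  -- Subsets of ℙⁿ(K) are represented by predicates on nonzero coordinate
  -- vectors (all predicates below are invariant under nonzero scaling).
  -- The projective line L spanned by p, q:
  OnLine : ∀ {n} → Coord n → Coord n → Coord n → Set (c ⊔ ℓ)
  OnLine p q w = NonZeroVec w × (∃ λ s → ∃ λ t → ∀ i → w i ≈ s * p i + t * q i)

  InLineHyp : ∀ {n} → Coord n → Coord n → Fin (suc n) → Coord n → Set (c ⊔ ℓ)
  InLineHyp p q i w = OnLine p q w × (w i ≈ 0#)

  SameSet : ∀ {n} → (Coord n → Set (c ⊔ ℓ)) → (Coord n → Set (c ⊔ ℓ)) → Set (c ⊔ ℓ)
  SameSet A B = ∀ w → NonZeroVec w → (A w → B w) × (B w → A w)

-- For each i the vector wⁱ = qᵢ p − pᵢ q is a point of L ∩ Hᵢ, and wⁱₖ ≠ 0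
-- shows L ∩ Hᵢ ≠ L ∩ Hₖ. Since u₀ ≠ 0 and p, q are independent, some j has
-- w⁰ⱼ ≠ 0. If no k separated both 0 and j, then wʲ would vanish outside
-- I = {k | w⁰ₖ = 0}, the indices where (pₖ : qₖ) = (p₀ : q₀). On I the
-- coordinates of the two points u and wʲ of L are proportional, so
-- ∑_{k∈I} uₖ is a nonzero multiple of ∑_{k∈I} wʲₖ = ∑ₖ wʲₖ = 0 (as L ⊆ L₀),
-- a vanishing subsum with 0 ∈ I and j ∉ I.
module Submission where

open import Defs
open import Level using (_⊔_)
open import Data.Nat using (ℕ; suc; _≤_; _<_; z≤n; s≤s)
open import Data.Nat.Properties using (≤-pred; ≤-trans)
open import Data.Fin using (Fin; zero) renaming (suc to fsuc)
open import Data.Fin.Properties using (any?)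
open import Data.Fin.Subset using (Subset; ∣_∣; _∈_; _∉_; ⊤)
open import Data.Fin.Subset.Properties using (p⊂q⇒∣p∣<∣q∣; ∣⊤∣≡n; ⊆⊤; ∈⊤; ∣p∣≤∣x∷p∣)
open import Data.Vec using (lookup; tabulate; here; there)
open import Data.Vec.Properties using (lookup∘tabulate; lookup⇒[]=; []=⇒lookup)
open import Data.Vec.Functional using (Vector)
open import Data.Bool using (true; false; if_then_else_)
open import Data.Product using (∃; _×_; _,_; proj₁; proj₂)
open import Data.Empty using (⊥-elim)
open import Function using (_∘_)
open import Relation.Nullary using (¬_; Dec; yes; no; does; ¬?; contradiction)
open import Relation.Nullary.Decidable using (_×-dec_; dec-true; dec-false; decidable-stable)
open import Relation.Binary.PropositionalEquality using (subst)
import Relation.Binary.PropositionalEquality as ≡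
open import Algebra.Bundles using (Semiring; CommutativeSemiring)
import Algebra.Properties.Monoid.Sum as MonoidSum
import Algebra.Properties.Semiring.Sum as SemiringSum
import Algebra.Properties.Ring as RingProperties
import Algebra.Solver.Ring.NaturalCoefficients.Default as NaturalSolver
import Relation.Binary.Reasoning.Setoid as SetoidReasoning

x∈p⇒0<∣p∣ : ∀ {m} {x : Fin m} {p : Subset m} → x ∈ p → 0 < ∣ p ∣
x∈p⇒0<∣p∣ here = s≤s z≤n
x∈p⇒0<∣p∣ (there {y = y} {xs = p} x∈p) = ≤-trans (x∈p⇒0<∣p∣ x∈p) (∣p∣≤∣x∷p∣ y p)

x∉p⇒∣p∣≤n : ∀ {n} {x : Fin (suc n)} {p : Subset (suc n)} → x ∉ p → ∣ p ∣ ≤ n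
x∉p⇒∣p∣≤n {n} {x} {p} x∉p =
  ≤-pred (subst (∣ p ∣ <_) (∣⊤∣≡n (suc n)) (p⊂q⇒∣p∣<∣q∣ (⊆⊤ , x , ∈⊤ , x∉p)))

module _ {r ℓ} (R : Semiring r ℓ) where
  open Semiring R hiding (zero)
  open MonoidSum *-monoid renaming (sum to product)

  product≈0 : ∀ {m} (u : Vector Carrier m) k → u k ≈ 0# → product u ≈ 0#
  product≈0 u zero     uₖ≈0 = trans (*-congʳ uₖ≈0) (zeroˡ _)
  product≈0 u (fsuc k) uₖ≈0 = trans (*-congˡ (product≈0 (u ∘ fsuc) k uₖ≈0)) (zeroʳ _)

module _ {r ℓ} (R : CommutativeSemiring r ℓ) where
  open CommutativeSemiring R
  open NaturalSolver R using (solve; _:=_; _:+_; _:*_)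
  open SetoidReasoning setoid

  bilinear-swap : ∀ a b c d s t s′ t′ → b * c ≈ a * d →
    (s′ * a + t′ * b) * (s * c + t * d) ≈ (s * a + t * b) * (s′ * c + t′ * d)
  bilinear-swap a b c d s t s′ t′ bc≈ad = begin
    (s′ * a + t′ * b) * (s * c + t * d)
      ≈⟨ solve 8 (λ a b c d s t s′ t′ →
           (s′ :* a :+ t′ :* b) :* (s :* c :+ t :* d)
           := s′ :* s :* (a :* c) :+ s′ :* t :* (a :* d) :+ t′ :* s :* (b :* c) :+ t′ :* t :* (b :* d))
           refl a b c d s t s′ t′ ⟩
    s′ * s * (a * c) + s′ * t * (a * d) + t′ * s * (b * c) + t′ * t * (b * d)
      ≈⟨ +-congʳ (+-cong (+-congˡ (*-congˡ (sym bc≈ad))) (*-congˡ bc≈ad)) ⟩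
    s′ * s * (a * c) + s′ * t * (b * c) + t′ * s * (a * d) + t′ * t * (b * d)
      ≈⟨ solve 8 (λ a b c d s t s′ t′ →
           s′ :* s :* (a :* c) :+ s′ :* t :* (b :* c) :+ t′ :* s :* (a :* d) :+ t′ :* t :* (b :* d)
           := (s :* a :+ t :* b) :* (s′ :* c :+ t′ :* d))
           refl a b c d s t s′ t′ ⟩
    (s * a + t * b) * (s′ * c + t′ * d) ∎

module FieldProperties {c ℓ} (K : Field c ℓ) where
  open Field K
  open Proj K
  open SemiringSum semiring using (sum-cong-≋; *-distribˡ-sum)
  open SetoidReasoning setoid

  x*y≈0⇒y≈0 : ∀ {x y} → ¬ x ≈ 0# → x * y ≈ 0# → y ≈ 0#
  x*y≈0⇒y≈0 {x} {y} x≉0 xy≈0 with inverse x x≉0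
  ... | x⁻¹ , xx⁻¹≈1 = begin
    y              ≈⟨ *-identityˡ y ⟨
    1# * y         ≈⟨ *-congʳ (trans (sym xx⁻¹≈1) (*-comm x x⁻¹)) ⟩
    x⁻¹ * x * y    ≈⟨ *-assoc x⁻¹ x y ⟩
    x⁻¹ * (x * y)  ≈⟨ *-congˡ xy≈0 ⟩
    x⁻¹ * 0#       ≈⟨ zeroʳ x⁻¹ ⟩
    0#             ∎

  module _ {n} {I : Subset (suc n)} where

    sumOver≈Σ : ∀ {v : Coord n} → (∀ k → k ∉ I → v k ≈ 0#) → sumOver I v ≈ Σ⟨ v ⟩
    sumOver≈Σ {v} vanishes = sum-cong-≋ pointwise
      where
      pointwise : ∀ k → (if lookup I k then v k else 0#) ≈ v k
      pointwise k with lookup I k in eq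
      ... | true  = refl
      ... | false = sym (vanishes k λ k∈I → contradiction (≡.trans (≡.sym ([]=⇒lookup k∈I)) eq) λ ())

    sumOver-proportional : ∀ {a b} {u v : Coord n} → (∀ k → k ∈ I → a * u k ≈ b * v k) →
                           a * sumOver I u ≈ b * sumOver I v
    sumOver-proportional {a} {b} {u} {v} proportional = begin
      a * sumOver I u                                 ≈⟨ *-distribˡ-sum a (λ k → if lookup I k then u k else 0#) ⟩
      Σ⟨ (λ k → a * (if lookup I k then u k else 0#)) ⟩ ≈⟨ sum-cong-≋ pointwise ⟩
      Σ⟨ (λ k → b * (if lookup I k then v k else 0#)) ⟩ ≈⟨ *-distribˡ-sum b (λ k → if lookup I k then v k else 0#) ⟨
      b * sumOver I v                                 ∎
      where
      pointwise : ∀ k → a * (if lookup I k then u k else 0#) ≈ b * (if lookup I k then v k else 0#)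
      pointwise k with lookup I k in eq
      ... | true  = proportional k (lookup⇒[]= k I eq)
      ... | false = trans (zeroʳ a) (sym (zeroʳ b))

  zeros : ∀ {m} → Vector Carrier m → Subset m
  zeros v = tabulate (λ k → does (v k ≟ 0#))

  module _ {m} {v : Vector Carrier m} {k : Fin m} where

    ∈-zeros⁺ : v k ≈ 0# → k ∈ zeros v
    ∈-zeros⁺ vₖ≈0 = lookup⇒[]= k (zeros v) (≡.trans (lookup∘tabulate _ k) (dec-true (v k ≟ 0#) vₖ≈0))

    ∉-zeros⁺ : ¬ v k ≈ 0# → k ∉ zeros v
    ∉-zeros⁺ vₖ≉0 k∈ = contradiction
      (≡.trans (≡.sym ([]=⇒lookup k∈)) (≡.trans (lookup∘tabulate _ k) (dec-false (v k ≟ 0#) vₖ≉0))) λ ()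

    ∈-zeros⁻ : k ∈ zeros v → v k ≈ 0#
    ∈-zeros⁻ k∈ = decidable-stable (v k ≟ 0#) λ vₖ≉0 → ∉-zeros⁺ vₖ≉0 k∈

module Line {c ℓ} (K : Field c ℓ) {n : ℕ} (p q : Proj.Coord K n) where
  open Field K hiding (zero)
  open Proj K
  open FieldProperties K
  open RingProperties ring using (-‿distribˡ-*; x∙y⁻¹≈ε⇒x≈y; x≈y⇒x∙y⁻¹≈ε; -‿injective; -0#≈0#)
  open SetoidReasoning setoid

  InSpan : Coord n → Set (c ⊔ ℓ)
  InSpan w = ∃ λ s → ∃ λ t → ∀ i → w i ≈ s * p i + t * q i

  meet : Fin (suc n) → Coord n
  meet i k = q i * p k + - p i * q k

  meet-inSpan : ∀ i → InSpan (meet i)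
  meet-inSpan i = q i , - p i , λ _ → refl

  module _ {i k : Fin (suc n)} where

    meet≈0⁻ : meet i k ≈ 0# → q i * p k ≈ p i * q k
    meet≈0⁻ mᵢₖ≈0 = x∙y⁻¹≈ε⇒x≈y _ _ (trans (+-congˡ (-‿distribˡ-* (p i) (q k))) mᵢₖ≈0)

    meet≈0⁺ : q i * p k ≈ p i * q k → meet i k ≈ 0#
    meet≈0⁺ qᵢpₖ≈pᵢqₖ = trans (+-congˡ (sym (-‿distribˡ-* (p i) (q k)))) (x≈y⇒x∙y⁻¹≈ε qᵢpₖ≈pᵢqₖ)

  meet-self : ∀ i → meet i i ≈ 0#
  meet-self i = meet≈0⁺ (*-comm (q i) (p i))

  meet≈0-sym : ∀ {i k} → meet i k ≈ 0# → meet k i ≈ 0#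
  meet≈0-sym mᵢₖ≈0 = meet≈0⁺ (trans (*-comm _ _) (trans (sym (meet≈0⁻ mᵢₖ≈0)) (*-comm _ _)))

  meet≉0⇒distinct : ∀ {i j} → ¬ meet i j ≈ 0# → ¬ SameSet (InLineHyp p q i) (InLineHyp p q j)
  meet≉0⇒distinct {i} {j} mᵢⱼ≉0 same =
    mᵢⱼ≉0 (proj₂ (proj₁ (same (meet i) nonzero) ((nonzero , meet-inSpan i) , meet-self i)))
    where
    nonzero : NonZeroVec (meet i)
    nonzero = j , mᵢⱼ≉0

  inSpan-proportional : ∀ {u w i k} → InSpan u → InSpan w → meet i k ≈ 0# → w i * u k ≈ u i * w k
  inSpan-proportional {u} {w} {i} {k} (s , t , u≈) (s′ , t′ , w≈) mᵢₖ≈0 = begin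
    w i * u k                                   ≈⟨ *-cong (w≈ i) (u≈ k) ⟩
    (s′ * p i + t′ * q i) * (s * p k + t * q k)
      ≈⟨ bilinear-swap commutativeSemiring (p i) (q i) (p k) (q k) s t s′ t′ (meet≈0⁻ mᵢₖ≈0) ⟩
    (s * p i + t * q i) * (s′ * p k + t′ * q k) ≈⟨ *-cong (u≈ i) (w≈ k) ⟨
    u i * w k                                   ∎

  meet-nondegenerate : LinIndep p q → ∀ {u i} → InSpan u → ¬ u i ≈ 0# → ∃ λ j → ¬ meet i j ≈ 0#
  meet-nondegenerate indep {u} {i} (s , t , u≈) uᵢ≉0 with any? (λ j → ¬? (meet i j ≟ 0#))
  ... | yes found = found
  ... | no none = contradiction uᵢ≈0 uᵢ≉0
    where
    qᵢ≈0×-pᵢ≈0 : q i ≈ 0# × - p i ≈ 0#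
    qᵢ≈0×-pᵢ≈0 = indep (q i) (- p i) (λ j → decidable-stable (meet i j ≟ 0#) (none ∘ (j ,_)))
    pᵢ≈0 : p i ≈ 0#
    pᵢ≈0 = -‿injective (trans (proj₂ qᵢ≈0×-pᵢ≈0) (sym -0#≈0#))
    uᵢ≈0 : u i ≈ 0#
    uᵢ≈0 = begin
      u i               ≈⟨ u≈ i ⟩
      s * p i + t * q i ≈⟨ +-cong (*-congˡ pᵢ≈0) (*-congˡ (proj₁ qᵢ≈0×-pᵢ≈0)) ⟩
      s * 0# + t * 0#   ≈⟨ +-cong (zeroʳ s) (zeroʳ t) ⟩
      0# + 0#           ≈⟨ +-identityˡ 0# ⟩
      0#                ∎

  sumOver-zeros-meet≈0 : ∀ {u i j} → InSpan u → Σ⟨ meet j ⟩ ≈ 0# → ¬ meet j i ≈ 0# →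
                         (∀ k → ¬ meet i k ≈ 0# → meet j k ≈ 0#) → sumOver (zeros (meet i)) u ≈ 0#
  sumOver-zeros-meet≈0 {u} {i} {j} u∈L Σmⱼ≈0 mⱼᵢ≉0 separated = x*y≈0⇒y≈0 mⱼᵢ≉0 (begin
    meet j i * sumOver I u   ≈⟨ sumOver-proportional {I = I} proportional-on-I ⟩
    u i * sumOver I (meet j) ≈⟨ *-congˡ (trans (sumOver≈Σ {I = I} vanishes-off-I) Σmⱼ≈0) ⟩
    u i * 0#                 ≈⟨ zeroʳ (u i) ⟩
    0#                       ∎)
    where
    I : Subset (suc n)
    I = zeros (meet i)
    proportional-on-I : ∀ k → k ∈ I → meet j i * u k ≈ u i * meet j k
    proportional-on-I k = inSpan-proportional u∈L (meet-inSpan j) ∘ ∈-zeros⁻ {v = meet i}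
    vanishes-off-I : ∀ k → k ∉ I → meet j k ≈ 0#
    vanishes-off-I k k∉I = separated k (k∉I ∘ ∈-zeros⁺ {v = meet i})

  ThreeDistinctIntersections : Set (c ⊔ ℓ)
  ThreeDistinctIntersections = ∃ λ i → ∃ λ j → ∃ λ k →
      ¬ SameSet (InLineHyp p q i) (InLineHyp p q j)
    × ¬ SameSet (InLineHyp p q i) (InLineHyp p q k)
    × ¬ SameSet (InLineHyp p q j) (InLineHyp p q k)

lemma6p2 : ∀ {c ℓ} (K : Field c ℓ) → let open Field K in let open Proj K in
    (n : ℕ) → 1 ≤ n →
    (p q : Coord n) → LinIndep p q →
    (∀ w → OnLine p q w → Σ⟨ w ⟩ ≈ 0#) →
    (∃ λ (u : Coord n) → OnLine p q u × ¬ (Π⟨ u ⟩ ≈ 0#)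
        × (∀ (I : Subset (suc n)) → 1 ≤ ∣ I ∣ → ∣ I ∣ ≤ n → ¬ (sumOver I u ≈ 0#))) →
    ∃ λ (i : Fin (suc n)) → ∃ λ (j : Fin (suc n)) → ∃ λ (k : Fin (suc n)) →
        ¬ SameSet (InLineHyp p q i) (InLineHyp p q j)
      × ¬ SameSet (InLineHyp p q i) (InLineHyp p q k)
      × ¬ SameSet (InLineHyp p q j) (InLineHyp p q k)
lemma6p2 K n _ p q indep Σ≈0 (u , (_ , u∈L) , Π≉0 , noVanishingSubsum) =
  conclude (any? λ k → ¬? (meet zero k ≟ 0#) ×-dec ¬? (meet j k ≟ 0#))
  where
  open Field K hiding (zero)
  open FieldProperties K
  open Line K p q

  separated-from-zero : ∃ λ j → ¬ meet zero j ≈ 0#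
  separated-from-zero = meet-nondegenerate indep u∈L (Π≉0 ∘ product≈0 semiring u zero)

  j : Fin (suc n)
  j = proj₁ separated-from-zero

  m₀ⱼ≉0 : ¬ meet zero j ≈ 0#
  m₀ⱼ≉0 = proj₂ separated-from-zero

  mⱼ₀≉0 : ¬ meet j zero ≈ 0#
  mⱼ₀≉0 = m₀ⱼ≉0 ∘ meet≈0-sym

  conclude : Dec (∃ λ k → ¬ meet zero k ≈ 0# × ¬ meet j k ≈ 0#) → ThreeDistinctIntersections
  conclude (yes (k , m₀ₖ≉0 , mⱼₖ≉0)) =
    j , zero , k , meet≉0⇒distinct mⱼ₀≉0 , meet≉0⇒distinct mⱼₖ≉0 , meet≉0⇒distinct m₀ₖ≉0
  conclude (no none) = ⊥-elim (noVanishingSubsum (zeros (meet zero))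
    (x∈p⇒0<∣p∣ (∈-zeros⁺ {v = meet zero} (meet-self zero)))
    (x∉p⇒∣p∣≤n (∉-zeros⁺ {v = meet zero} m₀ⱼ≉0))
    (sumOver-zeros-meet≈0 u∈L (Σ≈0 (meet j) ((zero , mⱼ₀≉0) , meet-inSpan j)) mⱼ₀≉0 separated))
    where
    separated : ∀ k → ¬ meet zero k ≈ 0# → meet j k ≈ 0#
    separated k m₀ₖ≉0 = decidable-stable (meet j k ≟ 0#) (λ mⱼₖ≉0 → none (k , m₀ₖ≉0 , mⱼₖ≉0))
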